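{- Let $\lambda\geq 1$, let $\Gamma=\mathbf{K}_2^{(\lambda)}$ with vertex set $V=\{\alpha,\beta\}$ and edge set $E$, and let $G=\langle g\rangle\leq\mathrm{Aut}\,\Gamma$ be a cyclic subgroup which is regular or bi-regular on $E$. Let $y\in\mathrm{Aut}\,\Gamma$ be the automorphism interchanging $\alpha,\beta$ and fixing every edge, and let $G_{(E)}$ denote the kernel of the action of $G$ on $E$. (a) There is $x\in\mathrm{Aut}\,\Gamma$ fixing $\alpha$ and $\beta$ and acting on $E$ as a cycle of length $\lambda$ (so $L=\langle x\rangle\cong\mathbb{Z}_\lambda$ is regular on $E$) such that $G\leq\langle x\rangle\times\langle y\rangle$ and one of the following holds: (1) $G=\langle x\rangle\times\langle y\rangle$, $|G|=2\lambda$, $G$ transitive on $V$ and regular on $E$, $\lambda$ odd, $G_{(E)}\neq 1$; (2) $G=\langle xy\rangle$, $|G|=\lambda$, $G$ transitive on $V$ and regular on $E$, $\lambda$ even; (3) $G=\langle x\rangle$, $|G|=\lambda$, $G$ trivial on $V$ and regular on $E$; (4) $\lambda=2\lambda_0$ with $\lambda_0$ odd, $G=\langle x^2\rangle\times\langle y\rangle$, $|G|=\lambda$, $G$ transitive on $V$ and bi-regular on $E$, $G_{(E)}\neq 1$; (5) $\lambda=2\lambda_0$ with $\lambda_0$ even, $G=\langle x^2y\rangle$, $|G|=\lambda_0$, $G$ transitive on $V$ and bi-regular on $E$; (6) $\lambda=2\lambda_0$, $G=\langle x^2\rangle$, $|G|=\lambda_0$, $G$ trivial on $V$ and bi-regular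 on $E$. (b) $\Gamma$ has a symmetrical Euler cycle $C$ if and only if $\lambda$ is even, and in this case $H(C)=\langle\varphi,\tau\rangle=D(C)$.
   Context: Graphs may have multiple edges (no loops); automorphisms are permutations of $V\cup E$ preserving $V$, $E$ and incidence. $\mathbf{K}_2^{(\lambda)}$ has two vertices and $\lambda$ edges joining them; its automorphism group is $\mathrm{Sym}(E)\times\mathrm{Sym}(V)$, with $\mathrm{Sym}(E)$ fixing $V$ pointwise and $\mathrm{Sym}(V)$ fixing $E$ pointwise. For $G$ acting on a finite set $\Omega$ with induced group $G^\Omega$: regular means $G^\Omega$ transitive with $|G^\Omega|=|\Omega|$; bi-regular means $G^\Omega$ has exactly two orbits with $|G^\Omega|=|\Omega|/2$. A cycle of length $\ell$ is a sequence $C=(e_1,\dots,e_\ell)$ of pairwise distinct edges with vertices $\alpha_0,\dots,\alpha_\ell=\alpha_0$ such that $e_i$ is incident with $\alpha_{i-1},\alpha_i$; it is an Euler cycle if it contains every edge. On $E(C)$ let $\varphi:e_i\mapsto e_{i+1}$, $\tau:e_i\mapsto e_{\ell+1-i}$ (indices mod $\ell$), $D(C)=\langle\varphi,\tau\rangle$. $H(C)$ is the group of restrictions to $E(C)$ of those automorphisms that leave $E(C)$ invariant and restrict to an element of $D(C)$. $C$ is symmetrical if some automorphism restricts to $\varphi^2$ on $E(C)$. -}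

module Defs where

open import Data.Nat using (ℕ; zero; suc; _*_; NonZero)
open import Data.Nat.DivMod using (_mod_)
open import Data.Fin using (Fin; zero; suc; toℕ; fromℕ; inject₁; opposite)
open import Data.Fin.Permutation using (Permutation′; _⟨$⟩ʳ_; _∘ₚ_; transpose)
  renaming (id to idₚ)
open import Data.Product using (Σ; ∃; _×_; _,_)
open import Data.Sum using (_⊎_)
open import Data.List using (List; []; _∷_)
open import Data.Bool using (Bool; true; false)
open import Relation.Binary.PropositionalEquality using (_≡_)
open import Relation.Nullary using (¬_)
open import Function using (_∘_)

HasCard : {A : Set} → (A → A → Set) → (A → Set) → ℕ → Set
HasCard {A} _≈_ P m =
  Σ (Fin m → A) λ f →
    (∀ i → P (f i)) ×
    (∀ i j → f i ≈ f j → i ≡ j) ×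
    (∀ a → P a → ∃ λ i → a ≈ f i)

_⇔_ : Set → Set → Set
A ⇔ B = (A → B) × (B → A)

-- The multigraph Γ = K₂^(l): vertices Fin 2 (α = zero, β = suc zero),
-- edges Fin l, every edge joins α and β.

ends : {l : ℕ} → Fin l → Fin 2 × Fin 2
ends _ = (zero , suc zero)

Joins : {l : ℕ} → Fin l → Fin 2 → Fin 2 → Set
Joins e a b = ends e ≡ (a , b) ⊎ ends e ≡ (b , a)

-- Aut Γ = Sym(E) × Sym(V) (as stated in the context)
record Aut (l : ℕ) : Set where
  constructor aut
  field
    onE : Permutation′ l
    onV : Permutation′ 2
open Aut public

_≈P_ : {n : ℕ} → Permutation′ n → Permutation′ n → Set
σ ≈P ρ = ∀ i → σ ⟨$⟩ʳ i ≡ ρ ⟨$⟩ʳ i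

_≈A_ : {l : ℕ} → Aut l → Aut l → Set
g ≈A h = (onE g ≈P onE h) × (onV g ≈P onV h)

idA : {l : ℕ} → Aut l
idA = aut idₚ idₚ

_·_ : {l : ℕ} → Aut l → Aut l → Aut l
g · h = aut (onE g ∘ₚ onE h) (onV g ∘ₚ onV h)

pow : {l : ℕ} → Aut l → ℕ → Aut l
pow g zero    = idA
pow g (suc k) = g · pow g k

yA : {l : ℕ} → Aut l
yA = aut idₚ (transpose zero (suc zero))

⟨_⟩ : {l : ℕ} → Aut l → Aut l → Set
⟨ g ⟩ h = ∃ λ k → h ≈A pow g k

-- membership in ⟨a⟩ × ⟨b⟩ (internal product; a, b commute in our uses)
⟨_⟩×⟨_⟩ : {l : ℕ} → Aut l → Aut l → Aut l → Set
⟨ a ⟩×⟨ b ⟩ h = ∃ λ i → ∃ λ j → h ≈A (pow a i · pow b j)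

SameSub : {l : ℕ} → (Aut l → Set) → (Aut l → Set) → Set
SameSub {l} P Q = (h : Aut l) → P h ⇔ Q h

SubOf : {l : ℕ} → (Aut l → Set) → (Aut l → Set) → Set
SubOf {l} P Q = (h : Aut l) → P h → Q h

OrderIs : {l : ℕ} → Aut l → ℕ → Set
OrderIs g m = HasCard _≈A_ ⟨ g ⟩ m

InducedE : {l : ℕ} → Aut l → Permutation′ l → Set
InducedE g σ = ∃ λ k → σ ≈P onE (pow g k)

OrderOnE : {l : ℕ} → Aut l → ℕ → Set
OrderOnE g m = HasCard _≈P_ (InducedE g) m

OrbE : {l : ℕ} → Aut l → Fin l → Fin l → Set
OrbE g e e′ = ∃ λ k → onE (pow g k) ⟨$⟩ʳ e ≡ e′

TransitiveE : {l : ℕ} → Aut l → Set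
TransitiveE {l} g = (e e′ : Fin l) → OrbE g e e′

TwoOrbitsE : {l : ℕ} → Aut l → Set
TwoOrbitsE {l} g = ∃ λ e₁ → ∃ λ e₂ → ¬ OrbE g e₁ e₂ × ((e : Fin l) → OrbE g e₁ e ⊎ OrbE g e₂ e)

RegularE : {l : ℕ} → Aut l → Set
RegularE {l} g = TransitiveE g × OrderOnE g l

-- bi-regular: two orbits and |G^E| = |E|/2  (read as 2·|G^E| = |E|)
BiRegularE : {l : ℕ} → Aut l → Set
BiRegularE {l} g = TwoOrbitsE g × ∃ λ m → OrderOnE g m × 2 * m ≡ l

TransitiveV : {l : ℕ} → Aut l → Set
TransitiveV g = (a b : Fin 2) → ∃ λ k → onV (pow g k) ⟨$⟩ʳ a ≡ b

TrivialV : {l : ℕ} → Aut l → Set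
TrivialV g = (k : ℕ) → onV (pow g k) ≈P idₚ

KernelENontrivial : {l : ℕ} → Aut l → Set
KernelENontrivial g = ∃ λ h → ⟨ g ⟩ h × (onE h ≈P idₚ) × ¬ (h ≈A idA)

powP : {n : ℕ} → Permutation′ n → ℕ → Permutation′ n
powP σ zero    = idₚ
powP σ (suc k) = σ ∘ₚ powP σ k

IsLCycle : {l : ℕ} → Permutation′ l → Set
IsLCycle {l} σ = ∃ λ e₀ →
  ((i j : Fin l) → powP σ (toℕ i) ⟨$⟩ʳ e₀ ≡ powP σ (toℕ j) ⟨$⟩ʳ e₀ → i ≡ j) ×
  (powP σ l ⟨$⟩ʳ e₀ ≡ e₀)

-- Cycles in Γ.  A cycle of length ℓ: edges e₁..e_ℓ (stored at indices
-- 0..ℓ-1), pairwise distinct, with vertices α₀..α_ℓ, α_ℓ = α₀, and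
-- e_i joining α_{i-1}, α_i.

record Cycle (l : ℕ) : Set where
  field
    len      : ℕ
    edge     : Fin len → Fin l
    vert     : Fin (suc len) → Fin 2
    distinct : (i j : Fin len) → edge i ≡ edge j → i ≡ j
    closed   : vert (fromℕ len) ≡ vert zero
    incident : (i : Fin len) → Joins (edge i) (vert (inject₁ i)) (vert (suc i))
open Cycle public

EulerCycle : {l : ℕ} → Cycle l → Set
EulerCycle {l} C = (e : Fin l) → ∃ λ i → edge C i ≡ e

-- index maps: φ : e_i ↦ e_{i+1}, τ : e_i ↦ e_{ℓ+1-i} (indices mod ℓ)
shiftI : {n : ℕ} → Fin n → Fin n
shiftI {suc n} i = suc (toℕ i) mod suc n

-- elements of D(C) = ⟨φ,τ⟩, represented by index maps Fin ℓ → Fin ℓ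
-- (d acts on E(C) by e_i ↦ e_{d i}); words in φ (true) and τ (false)
evalWord : {n : ℕ} → List Bool → Fin n → Fin n
evalWord []          = λ i → i
evalWord (true ∷ w)  = shiftI ∘ evalWord w
evalWord (false ∷ w) = opposite ∘ evalWord w

InD : {l : ℕ} (C : Cycle l) → (Fin (len C) → Fin (len C)) → Set
InD C d = ∃ λ w → (i : Fin (len C)) → d i ≡ evalWord w i

Symmetrical : {l : ℕ} → Cycle l → Set
Symmetrical C = ∃ λ a → (i : Fin (len C)) → onE a ⟨$⟩ʳ edge C i ≡ edge C (shiftI (shiftI i))

InH : {l : ℕ} (C : Cycle l) → (Fin (len C) → Fin (len C)) → Set
InH C d =
  (∃ λ a → ((i : Fin (len C)) → ∃ λ j → onE a ⟨$⟩ʳ edge C i ≡ edge C j) ×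
           ((i : Fin (len C)) → onE a ⟨$⟩ʳ edge C i ≡ edge C (d i)))
  × InD C d

-- Aut Γ = Sym(E) × Sym(V) and Sym(V) = {1, y}, so a cyclic G = ⟨g⟩ is determined by
-- the permutation σ of E induced by g and by whether g swaps α and β.  If G is regular
-- on E then σ is a λ-cycle x; if G is bi-regular then σ has two orbits of length λ/2
-- and interleaving them gives a λ-cycle x with x² = σ.  The six cases are then read off
-- from whether g swaps the vertices and from the parity of the order q of σ: when q is
-- odd, y = g^q and x (resp. x²) = g^(q+1), so G = ⟨x⟩ × ⟨y⟩ (resp. ⟨x²⟩ × ⟨y⟩).
-- For (b), the vertices of a cycle in Γ alternate between α and β, so every cycle has
-- even length; conversely for even λ the edges in any order form an Euler cycle, and
-- rotating E by two steps is symmetrical.  An Euler cycle meets every edge, so each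
-- index map in D(C) transports to a permutation of E, giving H(C) = D(C).
module Submission where

open import Defs
open import Data.Bool using (Bool; true; false)
open import Data.Empty using (⊥-elim)
open import Data.Fin as Fin
  using (Fin; zero; suc; toℕ; fromℕ; fromℕ<; inject₁; opposite; combine; remQuot)
open import Data.Fin.Permutation
  using (Permutation′; _⟨$⟩ʳ_; _⟨$⟩ˡ_; permutation; inverseˡ; inverseʳ; transpose)
  renaming (id to idₚ)
open import Data.Fin.Properties
  using ( any?; punchOut-injective; injective⇒≤; pigeonhole; cantor-schröder-bernstein
        ; toℕ-injective; toℕ-fromℕ<; toℕ-fromℕ; toℕ-inject₁; toℕ<n
        ; opposite-involutive; remQuot-combine; combine-injective )
open import Data.List using (List; []; _∷_)
open import Data.Nat as ℕ
  using (ℕ; zero; suc; _+_; _*_; _∸_; _≤_; _<_; _%_; _/_; NonZero; >-nonZero; >-nonZero⁻¹; s≤s; s≤s⁻¹)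
open import Data.Nat.Properties
open import Data.Nat.DivMod
  using (_mod_; m≡m%n+[m/n]*n; m%n<n; m%n%n≡m%n; m<n⇒m%n≡m; [m+n]%n≡m%n; %-distribˡ-+; m<n*o⇒m/o<n)
open import Data.Nat.Divisibility
  using (_∣_; divides; _∣?_; 1∣_; n∣n; ∣-trans; m%n≡0⇒n∣m; n∣m⇒m%n≡0; m*n∣⇒m∣; m*n∣⇒n∣; *-monoˡ-∣)
open import Data.Nat.Primality using (euclidsLemma; prime[2])
open import Data.Product using (∃; _×_; _,_; proj₁; proj₂; map₂)
open import Data.Sum using (_⊎_; inj₁; inj₂)
import Data.Sum as Sum
open import Function using (_∘_; id)
open import Function.Definitions using (Injective)
open import Relation.Binary.PropositionalEquality
open import Relation.Nullary using (¬_; yes; no)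

open ≡-Reasoning

leftInverse⇒injective : ∀ {A B : Set} {f : A → B} (g : B → A) → (∀ x → g (f x) ≡ x) →
                        Injective _≡_ _≡_ f
leftInverse⇒injective g g∘f≗id {x} {y} fx≡fy =
  trans (sym (g∘f≗id x)) (trans (cong g fx≡fy) (g∘f≗id y))

⟨$⟩ʳ-injective : ∀ {n} (π : Permutation′ n) → Injective _≡_ _≡_ (π ⟨$⟩ʳ_)
⟨$⟩ʳ-injective π = leftInverse⇒injective (π ⟨$⟩ˡ_) (λ _ → inverseˡ π)

injective⇒surjective : ∀ {n} (f : Fin n → Fin n) → Injective _≡_ _≡_ f → ∀ y → ∃ λ x → f x ≡ y
injective⇒surjective {zero}  f f-injective ()
injective⇒surjective {suc n} f f-injective y with any? (λ x → f x Fin.≟ y)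
... | yes hit = hit
... | no miss = ⊥-elim (1+n≰n (injective⇒≤ punched-injective))
  where
  avoids : ∀ x → y ≢ f x
  avoids x y≡fx = miss (x , sym y≡fx)

  punched : Fin (suc n) → Fin n
  punched x = Fin.punchOut (avoids x)

  punched-injective : Injective _≡_ _≡_ punched
  punched-injective {x} {x′} eq = f-injective (punchOut-injective (avoids x) (avoids x′) eq)

surjective⇒injective : ∀ {n} (f : Fin n → Fin n) → (∀ y → ∃ λ x → f x ≡ y) → Injective _≡_ _≡_ f
surjective⇒injective {n} f f-surjective = leftInverse⇒injective r r∘f≗id
  where
  r : Fin n → Fin n
  r y = proj₁ (f-surjective y)

  r-injective : Injective _≡_ _≡_ r
  r-injective = leftInverse⇒injective f (proj₂ ∘ f-surjective)

  r∘f≗id : ∀ x → r (f x) ≡ x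
  r∘f≗id x with injective⇒surjective r r-injective x
  ... | y , refl = cong r (proj₂ (f-surjective y))

injection⇒permutation : ∀ {n} (f : Fin n → Fin n) → Injective _≡_ _≡_ f → Permutation′ n
injection⇒permutation f f-injective =
  permutation f (proj₁ ∘ preimage) (proj₂ ∘ preimage) (λ x → f-injective (proj₂ (preimage (f x))))
  where
  preimage : ∀ y → ∃ λ x → f x ≡ y
  preimage = injective⇒surjective f f-injective

injective-wlog-≤ : ∀ {n} {R : Fin n → Fin n → Set} → (∀ {i j} → R i j → R j i) →
                   (∀ {i j} → toℕ i ≤ toℕ j → R i j → i ≡ j) → ∀ i j → R i j → i ≡ j
injective-wlog-≤ R-sym injective≤ i j r with ≤-total (toℕ i) (toℕ j)
... | inj₁ i≤j = injective≤ i≤j r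
... | inj₂ j≤i = sym (injective≤ j≤i (R-sym r))

∣∸-<⇒≡ : ∀ {p i j} .{{_ : NonZero p}} → i ≤ j → j < p → p ∣ j ∸ i → i ≡ j
∣∸-<⇒≡ {p} {i} {j} i≤j j<p p∣j∸i =
  ≤-antisym i≤j (m∸n≡0⇒m≤n (trans (sym (m<n⇒m%n≡m (≤-<-trans (m∸n≤m j i) j<p)))
                                  (n∣m⇒m%n≡0 (j ∸ i) p p∣j∸i)))

infixl 10 _^_

_^_ : ∀ {n} → Permutation′ n → ℕ → Fin n → Fin n
(σ ^ k) e = powP σ k ⟨$⟩ʳ e

module _ {n} (σ : Permutation′ n) where

  ^-+ : ∀ a b → σ ^ (a + b) ≗ σ ^ b ∘ σ ^ a
  ^-+ zero    b e = refl
  ^-+ (suc a) b e = ^-+ a b (σ ⟨$⟩ʳ e)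

  ^-suc : ∀ k → σ ^ suc k ≗ (σ ⟨$⟩ʳ_) ∘ σ ^ k
  ^-suc k e = trans (cong (λ j → (σ ^ j) e) (+-comm 1 k)) (^-+ k 1 e)

  ^-comm : ∀ a b → σ ^ a ∘ σ ^ b ≗ σ ^ b ∘ σ ^ a
  ^-comm a b e =
    trans (sym (^-+ b a e)) (trans (cong (λ k → (σ ^ k) e) (+-comm b a)) (^-+ a b e))

  ^-*-id : ∀ m → σ ^ m ≗ id → ∀ q → σ ^ (q * m) ≗ id
  ^-*-id m σᵐ≗id zero    e = refl
  ^-*-id m σᵐ≗id (suc q) e =
    trans (^-+ m (q * m) e) (trans (cong (σ ^ (q * m)) (σᵐ≗id e)) (^-*-id m σᵐ≗id q e))

  ^-% : ∀ m .{{_ : NonZero m}} → σ ^ m ≗ id → ∀ k → σ ^ k ≗ σ ^ (k % m)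
  ^-% m σᵐ≗id k e = begin
    (σ ^ k) e                           ≡⟨ cong (λ j → (σ ^ j) e) (m≡m%n+[m/n]*n k m) ⟩
    (σ ^ (k % m + k / m * m)) e         ≡⟨ ^-+ (k % m) (k / m * m) e ⟩
    (σ ^ (k / m * m)) ((σ ^ (k % m)) e) ≡⟨ ^-*-id m σᵐ≗id (k / m) _ ⟩
    (σ ^ (k % m)) e                     ∎

  ^-fixed-∸ : ∀ {i j} e → i ≤ j → (σ ^ i) e ≡ (σ ^ j) e →
              (σ ^ (j ∸ i)) ((σ ^ i) e) ≡ (σ ^ i) e
  ^-fixed-∸ {i} {j} e i≤j σⁱe≡σʲe =
    trans (sym (^-+ i (j ∸ i) e)) (trans (cong (λ k → (σ ^ k) e) (m+[n∸m]≡n i≤j)) (sym σⁱe≡σʲe))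

  ^-∸-id : ∀ {i j} → i ≤ j → σ ^ i ≗ σ ^ j → σ ^ (j ∸ i) ≗ id
  ^-∸-id {i} {j} i≤j σⁱ≗σʲ e = begin
    (σ ^ (j ∸ i)) e            ≡⟨ cong (σ ^ (j ∸ i)) (sym σⁱe′≡e) ⟩
    (σ ^ (j ∸ i)) ((σ ^ i) e′) ≡⟨ ^-fixed-∸ e′ i≤j (σⁱ≗σʲ e′) ⟩
    (σ ^ i) e′                 ≡⟨ σⁱe′≡e ⟩
    e                          ∎
    where
    e′ : Fin n
    e′ = powP σ i ⟨$⟩ˡ e

    σⁱe′≡e : (σ ^ i) e′ ≡ e
    σⁱe′≡e = inverseʳ (powP σ i)

^-cong : ∀ {n} {σ ρ : Permutation′ n} → σ ≈P ρ → ∀ k → σ ^ k ≗ ρ ^ k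
^-cong σ≈ρ zero    e = refl
^-cong {σ = σ} {ρ} σ≈ρ (suc k) e = trans (^-cong σ≈ρ k (σ ⟨$⟩ʳ e)) (cong (ρ ^ k) (σ≈ρ e))

^-* : ∀ {n} {σ ρ : Permutation′ n} m → (σ ⟨$⟩ʳ_) ≗ ρ ^ m → ∀ k → σ ^ k ≗ ρ ^ (k * m)
^-* m σ≗ρᵐ zero    e = refl
^-* {σ = σ} {ρ} m σ≗ρᵐ (suc k) e = begin
  (σ ^ k) (σ ⟨$⟩ʳ e)        ≡⟨ ^-* m σ≗ρᵐ k (σ ⟨$⟩ʳ e) ⟩
  (ρ ^ (k * m)) (σ ⟨$⟩ʳ e)  ≡⟨ cong (ρ ^ (k * m)) (σ≗ρᵐ e) ⟩
  (ρ ^ (k * m)) ((ρ ^ m) e) ≡⟨ sym (^-+ ρ m (k * m) e) ⟩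
  (ρ ^ (m + k * m)) e       ∎

^-combine : ∀ {n} {σ α β : Permutation′ n} r t → (α ⟨$⟩ʳ_) ≗ σ ^ r → (β ⟨$⟩ʳ_) ≗ σ ^ t →
            ∀ i j → β ^ j ∘ α ^ i ≗ σ ^ (i * r + j * t)
^-combine {σ = σ} {α} {β} r t α≗σʳ β≗σᵗ i j e = begin
  (β ^ j) ((α ^ i) e)             ≡⟨ ^-* t β≗σᵗ j _ ⟩
  (σ ^ (j * t)) ((α ^ i) e)       ≡⟨ cong (σ ^ (j * t)) (^-* r α≗σʳ i e) ⟩
  (σ ^ (j * t)) ((σ ^ (i * r)) e) ≡⟨ sym (^-+ σ (i * r) (j * t) e) ⟩
  (σ ^ (i * r + j * t)) e         ∎

idₚ-^ : ∀ {n} k → idₚ {n} ^ k ≗ id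
idₚ-^ zero    e = refl
idₚ-^ (suc k) e = idₚ-^ k e

HasOrder : ∀ {n} → Permutation′ n → ℕ → Set
HasOrder σ q = ∀ k → (σ ^ k ≗ id) ⇔ (q ∣ k)

⟨_⟩ₚ : ∀ {n} → Permutation′ n → Permutation′ n → Set
⟨ σ ⟩ₚ τ = ∃ λ k → τ ≈P powP σ k

-- A period d < m would let the m distinct powers be indexed by exponents mod d.
card⇒HasOrder : ∀ {n} (σ : Permutation′ n) m .{{_ : NonZero m}} → HasCard _≈P_ ⟨ σ ⟩ₚ m →
                HasOrder σ m
card⇒HasOrder σ m (enum , enum∈ , enum-injective , enum-covers) k = to k , from k
  where
  exponent : Fin m → ℕ
  exponent i = proj₁ (enum∈ i)

  enum≗ : ∀ i → (enum i ⟨$⟩ʳ_) ≗ σ ^ exponent i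
  enum≗ i = proj₂ (enum∈ i)

  no-short-period : ∀ d → 0 < d → d < m → ¬ σ ^ d ≗ id
  no-short-period d 0<d d<m σᵈ≗id = <⇒≱ d<m (injective⇒≤ residue-injective)
    where
    instance
      d≢0 : NonZero d
      d≢0 = >-nonZero 0<d

    residue : Fin m → Fin d
    residue i = fromℕ< (m%n<n (exponent i) d)

    residue-injective : Injective _≡_ _≡_ residue
    residue-injective {i} {j} eq = enum-injective i j λ e → begin
      enum i ⟨$⟩ʳ e              ≡⟨ enum≗ i e ⟩
      (σ ^ exponent i) e         ≡⟨ ^-% σ d σᵈ≗id (exponent i) e ⟩
      (σ ^ (exponent i % d)) e   ≡⟨ cong (λ r → (σ ^ r) e) same-residue ⟩
      (σ ^ (exponent j % d)) e   ≡⟨ sym (^-% σ d σᵈ≗id (exponent j) e) ⟩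
      (σ ^ exponent j) e         ≡⟨ sym (enum≗ j e) ⟩
      enum j ⟨$⟩ʳ e              ∎
      where
      same-residue : exponent i % d ≡ exponent j % d
      same-residue = trans (sym (toℕ-fromℕ< _)) (trans (cong toℕ eq) (toℕ-fromℕ< _))

  index : ℕ → Fin m
  index k = proj₁ (enum-covers (powP σ k) (k , λ _ → refl))

  index≗ : ∀ k → σ ^ k ≗ (enum (index k) ⟨$⟩ʳ_)
  index≗ k = proj₂ (enum-covers (powP σ k) (k , λ _ → refl))

  period≤m : ∃ λ d → 0 < d × d ≤ m × σ ^ d ≗ id
  period≤m with pigeonhole (n<1+n m) (index ∘ toℕ)
  ... | i , j , i<j , same-index =
    toℕ j ∸ toℕ i , m<n⇒0<n∸m i<j , ≤-trans (m∸n≤m (toℕ j) (toℕ i)) (s≤s⁻¹ (toℕ<n j)) ,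
    ^-∸-id σ (<⇒≤ i<j) λ e →
      trans (index≗ (toℕ i) e) (trans (cong (λ c → enum c ⟨$⟩ʳ e) same-index) (sym (index≗ (toℕ j) e)))

  σᵐ≗id : σ ^ m ≗ id
  σᵐ≗id with period≤m
  ... | d , 0<d , d≤m , σᵈ≗id with m≤n⇒m<n∨m≡n d≤m
  ...   | inj₁ d<m  = ⊥-elim (no-short-period d 0<d d<m σᵈ≗id)
  ...   | inj₂ refl = σᵈ≗id

  to : ∀ k → σ ^ k ≗ id → m ∣ k
  to k σᵏ≗id with k % m ℕ.≟ 0
  ... | yes k%m≡0 = m%n≡0⇒n∣m k m k%m≡0
  ... | no  k%m≢0 = ⊥-elim (no-short-period (k % m) (n≢0⇒n>0 k%m≢0) (m%n<n k m)
                              λ e → trans (sym (^-% σ m σᵐ≗id k e)) (σᵏ≗id e))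

  from : ∀ k → m ∣ k → σ ^ k ≗ id
  from _ (divides q refl) = ^-*-id σ m σᵐ≗id q

HasOrder-resp : ∀ {n} {σ ρ : Permutation′ n} {q} → σ ≈P ρ → HasOrder ρ q → HasOrder σ q
HasOrder-resp σ≈ρ ρ-order k =
  (λ σᵏ≗id → proj₁ (ρ-order k) (λ e → trans (sym (^-cong σ≈ρ k e)) (σᵏ≗id e))) ,
  (λ q∣k e → trans (^-cong σ≈ρ k e) (proj₂ (ρ-order k) q∣k e))

idₚ-order : ∀ {n} → HasOrder (idₚ {n}) 1
idₚ-order k = (λ _ → 1∣ k) , (λ _ → idₚ-^ k)

JointOrder : ∀ {n n′} → Permutation′ n → Permutation′ n′ → ℕ → Set
JointOrder σ π q = ∀ k → (σ ^ k ≗ id × π ^ k ≗ id) ⇔ (q ∣ k)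

module _ {n n′} {σ : Permutation′ n} {π : Permutation′ n′} {q} (σ-order : HasOrder σ q) where

  jointOrder-∣ : ∀ {p} → HasOrder π p → p ∣ q → JointOrder σ π q
  jointOrder-∣ π-order p∣q k =
    proj₁ (σ-order k) ∘ proj₁ ,
    λ q∣k → proj₂ (σ-order k) q∣k , proj₂ (π-order k) (∣-trans p∣q q∣k)

  jointOrder-odd : HasOrder π 2 → ¬ 2 ∣ q → JointOrder σ π (2 * q)
  jointOrder-odd π-order 2∤q k = to k , from k
    where
    to : ∀ k → σ ^ k ≗ id × π ^ k ≗ id → 2 * q ∣ k
    to k (σᵏ≗id , πᵏ≗id) with proj₁ (σ-order k) σᵏ≗id
    ... | divides c refl with euclidsLemma c q prime[2] (proj₁ (π-order (c * q)) πᵏ≗id)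
    ...   | inj₁ 2∣c = *-monoˡ-∣ q 2∣c
    ...   | inj₂ 2∣q = ⊥-elim (2∤q 2∣q)

    from : ∀ k → 2 * q ∣ k → σ ^ k ≗ id × π ^ k ≗ id
    from k 2q∣k = proj₂ (σ-order k) (m*n∣⇒n∣ 2 q 2q∣k) , proj₂ (π-order k) (m*n∣⇒m∣ 2 q 2q∣k)

swap₂ : Permutation′ 2
swap₂ = transpose zero (suc zero)

swap₂² : swap₂ ^ 2 ≗ id
swap₂² zero       = refl
swap₂² (suc zero) = refl

swap₂-moves : ∀ v → swap₂ ⟨$⟩ʳ v ≢ v
swap₂-moves zero       ()
swap₂-moves (suc zero) ()

swap₂-^-even : ∀ k → 2 ∣ k → swap₂ ^ k ≗ id
swap₂-^-even k 2∣k v =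
  trans (^-% swap₂ 2 swap₂² k v) (cong (λ r → (swap₂ ^ r) v) (n∣m⇒m%n≡0 k 2 2∣k))

swap₂-^-odd : ∀ k → ¬ 2 ∣ k → swap₂ ^ k ≗ (swap₂ ⟨$⟩ʳ_)
swap₂-^-odd k 2∤k v = trans (^-% swap₂ 2 swap₂² k v) (cong (λ r → (swap₂ ^ r) v) k%2≡1)
  where
  k%2≢0 : k % 2 ≢ 0
  k%2≢0 = 2∤k ∘ m%n≡0⇒n∣m k 2

  k%2≡1 : k % 2 ≡ 1
  k%2≡1 with k % 2 | m%n<n k 2 | k%2≢0
  ... | 0           | _               | ≢0 = ⊥-elim (≢0 refl)
  ... | 1           | _               | _  = refl
  ... | suc (suc _) | s≤s (s≤s ())    | _

swap₂-^-fixes⇒even : ∀ k v → (swap₂ ^ k) v ≡ v → 2 ∣ k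
swap₂-^-fixes⇒even k v fixed with 2 ∣? k
... | yes 2∣k = 2∣k
... | no  2∤k = ⊥-elim (swap₂-moves v (trans (sym (swap₂-^-odd k 2∤k v)) fixed))

swap₂-order : HasOrder swap₂ 2
swap₂-order k = (λ fixes → swap₂-^-fixes⇒even k zero (fixes zero)) , swap₂-^-even k

idₚ-or-swap₂ : (π : Permutation′ 2) → π ≈P idₚ ⊎ π ≈P swap₂
idₚ-or-swap₂ π with π ⟨$⟩ʳ zero in π0 | π ⟨$⟩ʳ suc zero in π1
... | zero     | suc zero = inj₁ λ { zero → π0 ; (suc zero) → π1 }
... | suc zero | zero     = inj₂ λ { zero → π0 ; (suc zero) → π1 }
... | zero     | zero     = ⊥-elim (0≢1 (⟨$⟩ʳ-injective π (trans π0 (sym π1))))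
  where
  0≢1 : zero ≢ suc zero
  0≢1 ()
... | suc zero | suc zero = ⊥-elim (0≢1 (⟨$⟩ʳ-injective π (trans π0 (sym π1))))
  where
  0≢1 : zero ≢ suc zero
  0≢1 ()

swap₂-power : (π : Permutation′ 2) → ∃ λ s → (π ⟨$⟩ʳ_) ≗ swap₂ ^ s
swap₂-power π with idₚ-or-swap₂ π
... | inj₁ π≈idₚ   = 0 , π≈idₚ
... | inj₂ π≈swap₂ = 1 , π≈swap₂

≈A-refl : ∀ {l} (g : Aut l) → g ≈A g
≈A-refl g = (λ _ → refl) , (λ _ → refl)

≈A-sym : ∀ {l} (g h : Aut l) → g ≈A h → h ≈A g
≈A-sym g h (E , V) = sym ∘ E , sym ∘ V

record ActsAs {l} (z : Aut l) (f : Fin l → Fin l) (h : Fin 2 → Fin 2) : Set where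
  constructor _,_
  field
    E≗ : (onE z ⟨$⟩ʳ_) ≗ f
    V≗ : (onV z ⟨$⟩ʳ_) ≗ h
open ActsAs

actsAs-≈A : ∀ {l} {z w : Aut l} {f f′ h h′} → ActsAs z f h → ActsAs w f′ h′ → f ≗ f′ → h ≗ h′ →
            z ≈A w
actsAs-≈A (zE , zV) (wE , wV) f≗f′ h≗h′ =
  (λ e → trans (zE e) (trans (f≗f′ e) (sym (wE e)))) ,
  (λ v → trans (zV v) (trans (h≗h′ v) (sym (wV v))))

actsAs-self : ∀ {l} (z : Aut l) → ActsAs z (onE z ⟨$⟩ʳ_) (onV z ⟨$⟩ʳ_)
actsAs-self z = (λ _ → refl) , (λ _ → refl)

≈A-actsAs : ∀ {l} (z : Aut l) {w f h} → z ≈A w → ActsAs w f h → ActsAs z f h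
≈A-actsAs z (E , V) (wE , wV) = (λ e → trans (E e) (wE e)) , (λ v → trans (V v) (wV v))

·-actsAs : ∀ {l} {a b : Aut l} {f f′ h h′} → ActsAs a f h → ActsAs b f′ h′ →
           ActsAs (a · b) (f′ ∘ f) (h′ ∘ h)
·-actsAs {b = b} {f′ = f′} {h′ = h′} (aE , aV) (bE , bV) =
  (λ e → trans (cong (onE b ⟨$⟩ʳ_) (aE e)) (bE _)) ,
  (λ v → trans (cong (onV b ⟨$⟩ʳ_) (aV v)) (bV _))

onE-pow : ∀ {l} (g : Aut l) k → (onE (pow g k) ⟨$⟩ʳ_) ≗ onE g ^ k
onE-pow g zero    e = refl
onE-pow g (suc k) e = onE-pow g k (onE g ⟨$⟩ʳ e)

onV-pow : ∀ {l} (g : Aut l) k → (onV (pow g k) ⟨$⟩ʳ_) ≗ onV g ^ k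
onV-pow g zero    v = refl
onV-pow g (suc k) v = onV-pow g k (onV g ⟨$⟩ʳ v)

pow-actsAs : ∀ {l} (g : Aut l) k → ActsAs (pow g k) (onE g ^ k) (onV g ^ k)
pow-actsAs g k = onE-pow g k , onV-pow g k

orbit-^ : ∀ {l} {g : Aut l} {e e′} → OrbE g e e′ → ∃ λ k → (onE g ^ k) e ≡ e′
orbit-^ {g = g} (k , gᵏe≡e′) = k , trans (sym (onE-pow g k _)) gᵏe≡e′

OrderOnE⇒HasOrder : ∀ {l} (g : Aut l) m .{{_ : NonZero m}} → OrderOnE g m → HasOrder (onE g) m
OrderOnE⇒HasOrder g m (enum , enum∈ , enum-injective , enum-covers) =
  card⇒HasOrder (onE g) m
    ( enum
    , (λ i → map₂ (λ {k} enumᵢ≈gᵏ e → trans (enumᵢ≈gᵏ e) (onE-pow g k e)) (enum∈ i))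
    , enum-injective
    , (λ τ → λ { (k , τ≈σᵏ) → enum-covers τ (k , λ e → trans (τ≈σᵏ e) (sym (onE-pow g k e))) }) )

jointOrder⇒OrderIs : ∀ {l} (g : Aut l) {p} .{{_ : NonZero p}} → JointOrder (onE g) (onV g) p →
                     OrderIs g p
jointOrder⇒OrderIs {l} g {p} order = enum , (λ i → toℕ i , ≈A-refl (enum i)) , enum-injective , covers
  where
  enum : Fin p → Aut l
  enum i = pow g (toℕ i)

  same-powers : ∀ {a b} → pow g a ≈A pow g b → onE g ^ a ≗ onE g ^ b × onV g ^ a ≗ onV g ^ b
  same-powers {a} {b} (E , V) =
    (λ e → trans (sym (onE-pow g a e)) (trans (E e) (onE-pow g b e))) ,
    (λ v → trans (sym (onV-pow g a v)) (trans (V v) (onV-pow g b v)))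

  enum-injective : ∀ i j → enum i ≈A enum j → i ≡ j
  enum-injective = injective-wlog-≤ (λ {i} {j} → ≈A-sym (enum i) (enum j)) λ {i} {j} i≤j same →
    toℕ-injective (∣∸-<⇒≡ i≤j (toℕ<n j)
      (proj₁ (order _) (^-∸-id (onE g) i≤j (proj₁ (same-powers {toℕ i} {toℕ j} same)) ,
                        ^-∸-id (onV g) i≤j (proj₂ (same-powers {toℕ i} {toℕ j} same)))))

  period : onE g ^ p ≗ id × onV g ^ p ≗ id
  period = proj₂ (order p) (n∣n {p})

  covers : ∀ h → ⟨ g ⟩ h → ∃ λ i → h ≈A enum i
  covers h (k , h≈gᵏ) = i , actsAs-≈A (≈A-actsAs h h≈gᵏ (pow-actsAs g k)) (pow-actsAs g (toℕ i))
      (λ e → trans (^-% (onE g) p (proj₁ period) k e) (cong (λ r → (onE g ^ r) e) toℕi≡))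
      (λ v → trans (^-% (onV g) p (proj₂ period) k v) (cong (λ r → (onV g ^ r) v) toℕi≡))
    where
    i : Fin p
    i = fromℕ< (m%n<n k p)

    toℕi≡ : k % p ≡ toℕ i
    toℕi≡ = sym (toℕ-fromℕ< _)

fixV-order : ∀ {l} (g : Aut l) {q} .{{_ : NonZero q}} → HasOrder (onE g) q → onV g ≈P idₚ →
             OrderIs g q
fixV-order g {q} E-order gV =
  jointOrder⇒OrderIs g (jointOrder-∣ E-order (HasOrder-resp gV idₚ-order) (1∣ q))

swapV-order-even : ∀ {l} (g : Aut l) {q} .{{_ : NonZero q}} → HasOrder (onE g) q →
                   onV g ≈P swap₂ → 2 ∣ q → OrderIs g q
swapV-order-even g E-order gV 2∣q =
  jointOrder⇒OrderIs g (jointOrder-∣ E-order (HasOrder-resp gV swap₂-order) 2∣q)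

swapV-order-odd : ∀ {l} (g : Aut l) {q} .{{_ : NonZero q}} → HasOrder (onE g) q →
                  onV g ≈P swap₂ → ¬ 2 ∣ q → OrderIs g (2 * q)
swapV-order-odd g {q} E-order gV 2∤q =
  jointOrder⇒OrderIs g {{m*n≢0 2 q}} (jointOrder-odd E-order (HasOrder-resp gV swap₂-order) 2∤q)

fixV⇒TrivialV : ∀ {l} (g : Aut l) → onV g ≈P idₚ → TrivialV g
fixV⇒TrivialV g gV k v = trans (onV-pow g k v) (trans (^-cong gV k v) (idₚ-^ k v))

swapV⇒TransitiveV : ∀ {l} (g : Aut l) → onV g ≈P swap₂ → TransitiveV g
swapV⇒TransitiveV g gV zero       zero       = 0 , refl
swapV⇒TransitiveV g gV zero       (suc zero) = 1 , gV zero
swapV⇒TransitiveV g gV (suc zero) zero       = 1 , gV (suc zero)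
swapV⇒TransitiveV g gV (suc zero) (suc zero) = 0 , refl

kernelE-nontrivial : ∀ {l} (g : Aut l) {q} → HasOrder (onE g) q → onV g ≈P swap₂ → ¬ 2 ∣ q →
                     KernelENontrivial g
kernelE-nontrivial g {q} E-order gV 2∤q = pow g q , (q , ≈A-refl (pow g q)) , fixesE , movesV
  where
  fixesE : onE (pow g q) ≈P idₚ
  fixesE e = trans (onE-pow g q e) (proj₂ (E-order q) (n∣n {q}) e)

  movesV : ¬ pow g q ≈A idA
  movesV (_ , V) = swap₂-moves zero (begin
    swap₂ ⟨$⟩ʳ zero          ≡⟨ sym (swap₂-^-odd q 2∤q zero) ⟩
    (swap₂ ^ q) zero         ≡⟨ sym (^-cong gV q zero) ⟩
    (onV g ^ q) zero         ≡⟨ sym (onV-pow g q zero) ⟩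
    onV (pow g q) ⟨$⟩ʳ zero  ≡⟨ V zero ⟩
    zero                     ∎)

⟨⟩-resp-≈A : ∀ {l} (g h : Aut l) → g ≈A h → SubOf ⟨ g ⟩ ⟨ h ⟩
⟨⟩-resp-≈A g h (E , V) z (k , z≈gᵏ) =
  k , actsAs-≈A (≈A-actsAs z z≈gᵏ (pow-actsAs g k)) (pow-actsAs h k) (^-cong E k) (^-cong V k)

≈A⇒SameSub : ∀ {l} (g h : Aut l) → g ≈A h → SameSub ⟨ g ⟩ ⟨ h ⟩
≈A⇒SameSub g h g≈h z = ⟨⟩-resp-≈A g h g≈h z , ⟨⟩-resp-≈A h g (≈A-sym g h g≈h) z

⟨⟩×⟨⟩⊆⟨⟩ : ∀ {l} {g a c : Aut l} → ⟨ g ⟩ a → ⟨ g ⟩ c → SubOf ⟨ a ⟩×⟨ c ⟩ ⟨ g ⟩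
⟨⟩×⟨⟩⊆⟨⟩ {g = g} {a} {c} (r , a≈gʳ) (t , c≈gᵗ) z (i , j , z≈aⁱcʲ) =
  i * r + j * t ,
  actsAs-≈A (≈A-actsAs z z≈aⁱcʲ (·-actsAs (pow-actsAs a i) (pow-actsAs c j))) (pow-actsAs g (i * r + j * t))
    (^-combine r t (E≗ a-acts) (E≗ c-acts) i j)
    (^-combine r t (V≗ a-acts) (V≗ c-acts) i j)
  where
  a-acts : ActsAs a (onE g ^ r) (onV g ^ r)
  a-acts = ≈A-actsAs a a≈gʳ (pow-actsAs g r)

  c-acts : ActsAs c (onE g ^ t) (onV g ^ t)
  c-acts = ≈A-actsAs c c≈gᵗ (pow-actsAs g t)

⟨⟩⊆⟨⟩×⟨yA⟩ : ∀ {l} (g x : Aut l) r → (onE g ⟨$⟩ʳ_) ≗ onE x ^ r → onV x ≈P idₚ →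
             SubOf ⟨ g ⟩ ⟨ x ⟩×⟨ yA ⟩
⟨⟩⊆⟨⟩×⟨yA⟩ g x r gE xV z (k , z≈gᵏ) with swap₂-power (onV g)
... | s , gV =
  k * r , k * s ,
  actsAs-≈A (≈A-actsAs z z≈gᵏ (pow-actsAs g k))
            (·-actsAs (pow-actsAs x (k * r)) (pow-actsAs yA (k * s)))
    (λ e → trans (^-* r gE k e) (sym (idₚ-^ (k * s) _)))
    (λ v → trans (^-* s gV k v)
                 (cong (swap₂ ^ (k * s)) (sym (trans (^-cong xV (k * r) v) (idₚ-^ (k * r) v)))))

⟨⟩≡⟨⟩×⟨yA⟩ : ∀ {l} (g b : Aut l) {q} → HasOrder (onE g) q → ¬ 2 ∣ q →
             onE g ≈P onE b → onV b ≈P idₚ → onV g ≈P swap₂ → SameSub ⟨ g ⟩ ⟨ b ⟩×⟨ yA ⟩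
⟨⟩≡⟨⟩×⟨yA⟩ g b {q} E-order 2∤q gE bV gV z =
  ⟨⟩⊆⟨⟩×⟨yA⟩ g b 1 gE bV z , ⟨⟩×⟨⟩⊆⟨⟩ b∈⟨g⟩ yA∈⟨g⟩ z
  where
  σ^q≗id : onE g ^ q ≗ id
  σ^q≗id = proj₂ (E-order q) (n∣n {q})

  π^q≗swap₂ : onV g ^ q ≗ (swap₂ ⟨$⟩ʳ_)
  π^q≗swap₂ v = trans (^-cong gV q v) (swap₂-^-odd q 2∤q v)

  yA∈⟨g⟩ : ⟨ g ⟩ yA
  yA∈⟨g⟩ = q , actsAs-≈A (actsAs-self yA) (pow-actsAs g q)
                 (sym ∘ σ^q≗id) (sym ∘ π^q≗swap₂)

  b∈⟨g⟩ : ⟨ g ⟩ b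
  b∈⟨g⟩ = suc q , actsAs-≈A (actsAs-self b) (pow-actsAs g (suc q))
    (λ e → trans (sym (gE e)) (sym (σ^q≗id (onE g ⟨$⟩ʳ e))))
    (λ v → begin
      onV b ⟨$⟩ʳ v                   ≡⟨ bV v ⟩
      v                              ≡⟨ sym (swap₂² v) ⟩
      swap₂ ⟨$⟩ʳ (swap₂ ⟨$⟩ʳ v)      ≡⟨ cong (swap₂ ⟨$⟩ʳ_) (sym (gV v)) ⟩
      swap₂ ⟨$⟩ʳ (onV g ⟨$⟩ʳ v)      ≡⟨ sym (π^q≗swap₂ _) ⟩
      (onV g ^ q) (onV g ⟨$⟩ʳ v)     ∎)

transitive-order⇒IsLCycle : ∀ {l} .{{_ : NonZero l}} (σ : Permutation′ l) →
                            (∀ e e′ → ∃ λ k → (σ ^ k) e ≡ e′) → HasOrder σ l → IsLCycle σ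
transitive-order⇒IsLCycle {l} σ transitive order =
  e₀ , injective-wlog-≤ sym distinct≤ , proj₂ (order l) (n∣n {l}) e₀
  where
  e₀ : Fin l
  e₀ = fromℕ< (>-nonZero⁻¹ l)

  fixes-all : ∀ d e → (σ ^ d) e ≡ e → σ ^ d ≗ id
  fixes-all d e fixed e′ with transitive e e′
  ... | k , refl = trans (^-comm σ d k e) (cong (σ ^ k) fixed)

  distinct≤ : ∀ {i j : Fin l} → toℕ i ≤ toℕ j → (σ ^ toℕ i) e₀ ≡ (σ ^ toℕ j) e₀ → i ≡ j
  distinct≤ {i} {j} i≤j same =
    toℕ-injective (∣∸-<⇒≡ i≤j (toℕ<n j) (proj₁ (order _) (fixes-all (toℕ j ∸ toℕ i) _ (^-fixed-∸ σ e₀ i≤j same))))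

-- ρ sends σᵏe₀ ↦ σᵏe₁ ↦ σᵏ⁺¹e₀.  It is well defined because the 2m points σᵏe_b
-- (b < 2, k < m) exhaust Fin (2m), hence are pairwise distinct.
private
  module SquareRoot {m} .{{_ : NonZero m}} (σ : Permutation′ (2 * m)) (σᵐ≗id : σ ^ m ≗ id)
                    (e₀ e₁ : Fin (2 * m))
                    (covered : ∀ e → (∃ λ k → (σ ^ k) e₀ ≡ e) ⊎ (∃ λ k → (σ ^ k) e₁ ≡ e)) where

    base : Fin 2 → Fin (2 * m)
    base zero       = e₀
    base (suc zero) = e₁

    point : Fin 2 → ℕ → Fin (2 * m)
    point b k = (σ ^ k) (base b)

    point-surjective : ∀ e → ∃ λ b → ∃ λ k → point b k ≡ e
    point-surjective e with covered e
    ... | inj₁ (k , p) = zero , k , p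
    ... | inj₂ (k , p) = suc zero , k , p

    point-≡ : ∀ b {k k′} → k % m ≡ k′ % m → point b k ≡ point b k′
    point-≡ b {k} {k′} k≡k′ =
      trans (^-% σ m σᵐ≗id k (base b)) (trans (cong (point b) k≡k′) (sym (^-% σ m σᵐ≗id k′ (base b))))

    residue : ℕ → Fin m
    residue k = fromℕ< (m%n<n k m)

    enum : Fin (2 * m) → Fin (2 * m)
    enum i = point (proj₁ (remQuot {2} m i)) (toℕ (proj₂ (remQuot {2} m i)))

    enum-combine : ∀ b k → enum (combine b (residue k)) ≡ point b k
    enum-combine b k = begin
      enum (combine b (residue k)) ≡⟨ cong (λ p → point (proj₁ p) (toℕ (proj₂ p))) (remQuot-combine {2} {m} b (residue k)) ⟩
      point b (toℕ (residue k))    ≡⟨ point-≡ b (trans (cong (_% m) (toℕ-fromℕ< _)) (m%n%n≡m%n k m)) ⟩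
      point b k                    ∎

    enum-surjective : ∀ e → ∃ λ i → enum i ≡ e
    enum-surjective e with point-surjective e
    ... | b , k , refl = combine b (residue k) , enum-combine b k

    point-injective : ∀ {b b′ k k′} → point b k ≡ point b′ k′ → b ≡ b′ × k % m ≡ k′ % m
    point-injective {b} {b′} {k} {k′} same =
      map₂ (λ r≡r′ → trans (sym (toℕ-fromℕ< _)) (trans (cong toℕ r≡r′) (toℕ-fromℕ< _)))
        (combine-injective b (residue k) b′ (residue k′)
          (surjective⇒injective enum enum-surjective
            (trans (enum-combine b k) (trans same (sym (enum-combine b′ k′))))))

    next : Fin 2 → ℕ → Fin (2 * m)
    next zero       k = point (suc zero) k
    next (suc zero) k = point zero (suc k)

    next-≡ : ∀ b {k k′} → k % m ≡ k′ % m → next b k ≡ next b k′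
    next-≡ zero       k≡k′ = point-≡ (suc zero) k≡k′
    next-≡ (suc zero) {k} {k′} k≡k′ =
      trans (^-suc σ k e₀) (trans (cong (σ ⟨$⟩ʳ_) (point-≡ zero k≡k′)) (sym (^-suc σ k′ e₀)))

    next-respects : ∀ {b b′ k k′} → point b k ≡ point b′ k′ → next b k ≡ next b′ k′
    next-respects {b} {b′} {k} {k′} same with point-injective {b} {b′} {k} {k′} same
    ... | refl , k≡k′ = next-≡ b k≡k′

    root : Fin (2 * m) → Fin (2 * m)
    root e = next (proj₁ (point-surjective e)) (proj₁ (proj₂ (point-surjective e)))

    root-point : ∀ b k → root (point b k) ≡ next b k
    root-point b k = next-respects {proj₁ preimage} {b} {proj₁ (proj₂ preimage)} {k} (proj₂ (proj₂ preimage))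
      where
      preimage : ∃ λ b′ → ∃ λ k′ → point b′ k′ ≡ point b k
      preimage = point-surjective (point b k)

    root²-point : ∀ b k → root (root (point b k)) ≡ σ ⟨$⟩ʳ point b k
    root²-point zero k = begin
      root (root (point zero k))  ≡⟨ cong root (root-point zero k) ⟩
      root (point (suc zero) k)   ≡⟨ root-point (suc zero) k ⟩
      point zero (suc k)          ≡⟨ ^-suc σ k e₀ ⟩
      σ ⟨$⟩ʳ point zero k         ∎
    root²-point (suc zero) k = begin
      root (root (point (suc zero) k)) ≡⟨ cong root (root-point (suc zero) k) ⟩
      root (point zero (suc k))        ≡⟨ root-point zero (suc k) ⟩
      point (suc zero) (suc k)         ≡⟨ ^-suc σ k e₁ ⟩
      σ ⟨$⟩ʳ point (suc zero) k        ∎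

    root² : ∀ e → root (root e) ≡ σ ⟨$⟩ʳ e
    root² e = subst (λ e → root (root e) ≡ σ ⟨$⟩ʳ e) (proj₂ (proj₂ preimage))
                    (root²-point (proj₁ preimage) (proj₁ (proj₂ preimage)))
      where
      preimage : ∃ λ b → ∃ λ k → point b k ≡ e
      preimage = point-surjective e

    root-injective : Injective _≡_ _≡_ root
    root-injective {e} {e′} same =
      ⟨$⟩ʳ-injective σ (trans (sym (root² e)) (trans (cong root same) (root² e′)))

    ρ : Permutation′ (2 * m)
    ρ = injection⇒permutation root root-injective

    σ≗ρ² : (σ ⟨$⟩ʳ_) ≗ ρ ^ 2
    σ≗ρ² e = sym (root² e)

    ρ^-base : ∀ b → (ρ ^ toℕ b) e₀ ≡ base b
    ρ^-base zero       = refl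
    ρ^-base (suc zero) = root-point zero 0

    ρ^-interleaved : ∀ b t → (ρ ^ (toℕ b + t * 2)) e₀ ≡ point b t
    ρ^-interleaved b t = begin
      (ρ ^ (toℕ b + t * 2)) e₀         ≡⟨ ^-+ ρ (toℕ b) (t * 2) e₀ ⟩
      (ρ ^ (t * 2)) ((ρ ^ toℕ b) e₀)   ≡⟨ sym (^-* 2 σ≗ρ² t _) ⟩
      (σ ^ t) ((ρ ^ toℕ b) e₀)         ≡⟨ cong (σ ^ t) (ρ^-base b) ⟩
      point b t                        ∎

    exponent-injective : ∀ {b b′ t t′} → t < m → t′ < m →
                         (ρ ^ (toℕ b + t * 2)) e₀ ≡ (ρ ^ (toℕ b′ + t′ * 2)) e₀ →
                         toℕ b + t * 2 ≡ toℕ b′ + t′ * 2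
    exponent-injective {b} {b′} {t} {t′} t<m t′<m same =
      cong₂ (λ c s → toℕ c + s * 2) (proj₁ same-point)
        (trans (sym (m<n⇒m%n≡m t<m)) (trans (proj₂ same-point) (m<n⇒m%n≡m t′<m)))
      where
      same-point : b ≡ b′ × t % m ≡ t′ % m
      same-point = point-injective (trans (sym (ρ^-interleaved b t)) (trans same (ρ^-interleaved b′ t′)))

    bit : Fin (2 * m) → Fin 2
    bit i = fromℕ< (m%n<n (toℕ i) 2)

    half : Fin (2 * m) → ℕ
    half i = toℕ i / 2

    half<m : ∀ i → half i < m
    half<m i = m<n*o⇒m/o<n (subst (toℕ i <_) (*-comm 2 m) (toℕ<n i))

    toℕ-bit-half : ∀ i → toℕ i ≡ toℕ (bit i) + half i * 2
    toℕ-bit-half i = trans (m≡m%n+[m/n]*n (toℕ i) 2) (cong (_+ half i * 2) (sym (toℕ-fromℕ< _)))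

    ρ-IsLCycle : IsLCycle ρ
    ρ-IsLCycle = e₀ , distinct-powers , closes
      where
      distinct-powers : (i j : Fin (2 * m)) → (ρ ^ toℕ i) e₀ ≡ (ρ ^ toℕ j) e₀ → i ≡ j
      distinct-powers i j same = toℕ-injective (begin
        toℕ i                      ≡⟨ toℕ-bit-half i ⟩
        toℕ (bit i) + half i * 2   ≡⟨ exponent-injective {bit i} {bit j} {half i} {half j}
                                        (half<m i) (half<m j)
                                        (subst₂ (λ a c → (ρ ^ a) e₀ ≡ (ρ ^ c) e₀)
                                                (toℕ-bit-half i) (toℕ-bit-half j) same) ⟩
        toℕ (bit j) + half j * 2   ≡⟨ sym (toℕ-bit-half j) ⟩
        toℕ j                      ∎)

      closes : (ρ ^ (2 * m)) e₀ ≡ e₀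
      closes = begin
        (ρ ^ (2 * m)) e₀  ≡⟨ cong (λ k → (ρ ^ k) e₀) (*-comm 2 m) ⟩
        (ρ ^ (m * 2)) e₀  ≡⟨ sym (^-* 2 σ≗ρ² m e₀) ⟩
        (σ ^ m) e₀        ≡⟨ σᵐ≗id e₀ ⟩
        e₀                ∎

square-root-cycle : ∀ {m} .{{_ : NonZero m}} (σ : Permutation′ (2 * m)) → σ ^ m ≗ id →
                    (e₀ e₁ : Fin (2 * m)) →
                    (∀ e → (∃ λ k → (σ ^ k) e₀ ≡ e) ⊎ (∃ λ k → (σ ^ k) e₁ ≡ e)) →
                    ∃ λ ρ → IsLCycle ρ × (σ ⟨$⟩ʳ_) ≗ ρ ^ 2
square-root-cycle σ σᵐ≗id e₀ e₁ covered = ρ , ρ-IsLCycle , σ≗ρ²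
  where open SquareRoot σ σᵐ≗id e₀ e₁ covered

Cases : (l : ℕ) → Aut l → Aut l → Set
Cases l g x =
    (SameSub ⟨ g ⟩ ⟨ x ⟩×⟨ yA ⟩ × OrderIs g (2 * l) × TransitiveV g × RegularE g
       × ¬ (2 ∣ l) × KernelENontrivial g)
  ⊎ (SameSub ⟨ g ⟩ ⟨ x · yA ⟩ × OrderIs g l × TransitiveV g × RegularE g × 2 ∣ l)
  ⊎ (SameSub ⟨ g ⟩ ⟨ x ⟩ × OrderIs g l × TrivialV g × RegularE g)
  ⊎ (∃ λ l₀ → l ≡ 2 * l₀ × ¬ (2 ∣ l₀) ×
       SameSub ⟨ g ⟩ ⟨ x · x ⟩×⟨ yA ⟩ × OrderIs g l × TransitiveV g × BiRegularE g
       × KernelENontrivial g)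
  ⊎ (∃ λ l₀ → l ≡ 2 * l₀ × 2 ∣ l₀ ×
       SameSub ⟨ g ⟩ ⟨ (x · x) · yA ⟩ × OrderIs g l₀ × TransitiveV g × BiRegularE g)
  ⊎ (∃ λ l₀ → l ≡ 2 * l₀ ×
       SameSub ⟨ g ⟩ ⟨ x · x ⟩ × OrderIs g l₀ × TrivialV g × BiRegularE g)

Classified : (l : ℕ) → Aut l → Set
Classified l g =
  ∃ λ x → onV x ≈P onV (idA {l}) × IsLCycle (onE x) × SubOf ⟨ g ⟩ ⟨ x ⟩×⟨ yA ⟩ × Cases l g x

regular-classified : ∀ {l} .{{_ : NonZero l}} (g : Aut l) → RegularE g → Classified l g
regular-classified {l} g regular@(transitive , card) =
  x , (λ _ → refl) , cycle , ⟨⟩⊆⟨⟩×⟨yA⟩ g x 1 (λ _ → refl) (λ _ → refl) , shape (idₚ-or-swap₂ (onV g))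
  where
  x : Aut l
  x = aut (onE g) idₚ

  E-order : HasOrder (onE g) l
  E-order = OrderOnE⇒HasOrder g l card

  cycle : IsLCycle (onE g)
  cycle = transitive-order⇒IsLCycle (onE g) (λ e e′ → orbit-^ (transitive e e′)) E-order

  shape : onV g ≈P idₚ ⊎ onV g ≈P swap₂ → Cases l g x
  shape (inj₁ gV) = inj₂ (inj₂ (inj₁
    (≈A⇒SameSub g x ((λ _ → refl) , gV) , fixV-order g E-order gV , fixV⇒TrivialV g gV , regular)))
  shape (inj₂ gV) with 2 ∣? l
  ... | yes 2∣l = inj₂ (inj₁
    ( ≈A⇒SameSub g (x · yA) ((λ _ → refl) , gV) , swapV-order-even g E-order gV 2∣l
    , swapV⇒TransitiveV g gV , regular , 2∣l ))
  ... | no 2∤l = inj₁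
    ( ⟨⟩≡⟨⟩×⟨yA⟩ g x E-order 2∤l (λ _ → refl) (λ _ → refl) gV , swapV-order-odd g E-order gV 2∤l
    , swapV⇒TransitiveV g gV , regular , 2∤l , kernelE-nontrivial g E-order gV 2∤l )

squareRoot-classified : ∀ m .{{_ : NonZero m}} (g : Aut (2 * m)) → BiRegularE g →
                        HasOrder (onE g) m → (ρ : Permutation′ (2 * m)) → IsLCycle ρ →
                        (onE g ⟨$⟩ʳ_) ≗ ρ ^ 2 → Classified (2 * m) g
squareRoot-classified m g biregular E-order ρ ρ-cycle σ≗ρ² =
  x , (λ _ → refl) , ρ-cycle , ⟨⟩⊆⟨⟩×⟨yA⟩ g x 2 σ≗ρ² (λ _ → refl) , shape (idₚ-or-swap₂ (onV g))
  where
  x : Aut (2 * m)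
  x = aut ρ idₚ

  shape : onV g ≈P idₚ ⊎ onV g ≈P swap₂ → Cases (2 * m) g x
  shape (inj₁ gV) = inj₂ (inj₂ (inj₂ (inj₂ (inj₂
    ( m , refl , ≈A⇒SameSub g (x · x) (σ≗ρ² , gV) , fixV-order g E-order gV
    , fixV⇒TrivialV g gV , biregular )))))
  shape (inj₂ gV) with 2 ∣? m
  ... | yes 2∣m = inj₂ (inj₂ (inj₂ (inj₂ (inj₁
    ( m , refl , 2∣m , ≈A⇒SameSub g ((x · x) · yA) (σ≗ρ² , gV) , swapV-order-even g E-order gV 2∣m
    , swapV⇒TransitiveV g gV , biregular )))))
  ... | no 2∤m = inj₂ (inj₂ (inj₂ (inj₁
    ( m , refl , 2∤m , ⟨⟩≡⟨⟩×⟨yA⟩ g (x · x) E-order 2∤m σ≗ρ² (λ _ → refl) gV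
    , swapV-order-odd g E-order gV 2∤m , swapV⇒TransitiveV g gV , biregular
    , kernelE-nontrivial g E-order gV 2∤m ))))

biregular-classified : ∀ m .{{_ : NonZero m}} (g : Aut (2 * m)) → TwoOrbitsE g → OrderOnE g m →
                       Classified (2 * m) g
biregular-classified m g twoOrbits@(e₀ , e₁ , _ , covered) card =
  squareRoot-classified m g (twoOrbits , m , card , refl) E-order
    (proj₁ root) (proj₁ (proj₂ root)) (proj₂ (proj₂ root))
  where
  E-order : HasOrder (onE g) m
  E-order = OrderOnE⇒HasOrder g m card

  root : ∃ λ ρ → IsLCycle ρ × (onE g ⟨$⟩ʳ_) ≗ ρ ^ 2
  root = square-root-cycle (onE g) (proj₂ (E-order m) (n∣n {m})) e₀ e₁
           (Sum.map orbit-^ orbit-^ ∘ covered)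

classified : ∀ l → 1 ≤ l → (g : Aut l) → RegularE g ⊎ BiRegularE g → Classified l g
classified l 1≤l g (inj₁ regular) = regular-classified {{>-nonZero 1≤l}} g regular
classified .(2 * 0) () g (inj₂ (_ , zero , _ , refl))
classified .(2 * suc m) _ g (inj₂ (twoOrbits , suc m , card , refl)) =
  biregular-classified (suc m) g twoOrbits card

Joins⇒swap₂ : ∀ {l} (e : Fin l) {a b} → Joins e a b → b ≡ swap₂ ⟨$⟩ʳ a
Joins⇒swap₂ e (inj₁ refl) = refl
Joins⇒swap₂ e (inj₂ refl) = refl

joins-swap₂ : ∀ {l} (e : Fin l) a → Joins e a (swap₂ ⟨$⟩ʳ a)
joins-swap₂ e zero       = inj₁ refl
joins-swap₂ e (suc zero) = inj₂ refl

vert-alternates : ∀ {l} (C : Cycle l) k (i : Fin (suc (len C))) → toℕ i ≡ k →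
                  vert C i ≡ (swap₂ ^ k) (vert C zero)
vert-alternates C zero    zero    refl = refl
vert-alternates C (suc k) (suc i) refl = begin
  vert C (suc i)                        ≡⟨ Joins⇒swap₂ (edge C i) (incident C i) ⟩
  swap₂ ⟨$⟩ʳ vert C (inject₁ i)         ≡⟨ cong (swap₂ ⟨$⟩ʳ_) (vert-alternates C k (inject₁ i) (toℕ-inject₁ i)) ⟩
  swap₂ ⟨$⟩ʳ (swap₂ ^ k) (vert C zero)  ≡⟨ sym (^-suc swap₂ k _) ⟩
  (swap₂ ^ suc k) (vert C zero)         ∎

cycle-length-even : ∀ {l} (C : Cycle l) → 2 ∣ len C
cycle-length-even C = swap₂-^-fixes⇒even (len C) (vert C zero)
  (trans (sym (vert-alternates C (len C) (fromℕ (len C)) (toℕ-fromℕ (len C)))) (closed C))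

EulerCycle⇒len≡ : ∀ {l} (C : Cycle l) → EulerCycle C → len C ≡ l
EulerCycle⇒len≡ C euler =
  cantor-schröder-bernstein (distinct C _ _)
    (leftInverse⇒injective (edge C) (proj₂ ∘ euler))

shiftI-injective : ∀ {n} → Injective _≡_ _≡_ (shiftI {n})
shiftI-injective {suc n} = leftInverse⇒injective unshift unshift-shiftI
  where
  unshift : Fin (suc n) → Fin (suc n)
  unshift j = (toℕ j + n) mod suc n

  unshift-shiftI : ∀ i → unshift (shiftI i) ≡ i
  unshift-shiftI i = toℕ-injective (begin
    toℕ (unshift (shiftI i))                 ≡⟨ toℕ-fromℕ< _ ⟩
    (toℕ (shiftI i) + n) % suc n             ≡⟨ cong (λ r → (r + n) % suc n) (toℕ-fromℕ< (m%n<n (suc (toℕ i)) (suc n))) ⟩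
    (suc (toℕ i) % suc n + n) % suc n        ≡⟨ cong (λ r → (suc (toℕ i) % suc n + r) % suc n)
                                                     (sym (m<n⇒m%n≡m (n<1+n n))) ⟩
    (suc (toℕ i) % suc n + n % suc n) % suc n ≡⟨ sym (%-distribˡ-+ (suc (toℕ i)) n (suc n)) ⟩
    (suc (toℕ i) + n) % suc n                ≡⟨ cong (_% suc n) (sym (+-suc (toℕ i) n)) ⟩
    (toℕ i + suc n) % suc n                  ≡⟨ [m+n]%n≡m%n (toℕ i) (suc n) ⟩
    toℕ i % suc n                            ≡⟨ m<n⇒m%n≡m (toℕ<n i) ⟩
    toℕ i                                    ∎)

opposite-injective : ∀ {n} → Injective _≡_ _≡_ (opposite {n})
opposite-injective = leftInverse⇒injective opposite opposite-involutive

evalWord-injective : ∀ {n} (w : List Bool) → Injective _≡_ _≡_ (evalWord {n} w)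
evalWord-injective []          eq = eq
evalWord-injective (true  ∷ w) eq = evalWord-injective w (shiftI-injective eq)
evalWord-injective (false ∷ w) eq = evalWord-injective w (opposite-injective eq)

alternatingCycle : ∀ l → 2 ∣ l → Cycle l
alternatingCycle l 2∣l = record
  { len      = l
  ; edge     = id
  ; vert     = λ i → (swap₂ ^ toℕ i) zero
  ; distinct = λ _ _ → id
  ; closed   = trans (cong (λ k → (swap₂ ^ k) zero) (toℕ-fromℕ l)) (swap₂-^-even l 2∣l zero)
  ; incident = λ i → subst₂ (Joins i) (cong (λ k → (swap₂ ^ k) zero) (sym (toℕ-inject₁ i)))
                                     (sym (^-suc swap₂ (toℕ i) zero))
                                     (joins-swap₂ i ((swap₂ ^ toℕ i) zero))
  }

symmetricalEulerCycle⇔2∣ : ∀ l → (∃ λ (C : Cycle l) → EulerCycle C × Symmetrical C) ⇔ (2 ∣ l)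
symmetricalEulerCycle⇔2∣ l =
  (λ { (C , euler , _) → subst (2 ∣_) (EulerCycle⇒len≡ C euler) (cycle-length-even C) }) ,
  (λ 2∣l → alternatingCycle l 2∣l , (λ e → e , refl) , rotate² , λ _ → refl)
  where
  rotate² : Aut l
  rotate² = aut (injection⇒permutation (shiftI ∘ shiftI)
                   (λ eq → shiftI-injective (shiftI-injective eq))) idₚ

InD⇒InH : ∀ {l} (C : Cycle l) → EulerCycle C → ∀ d → InD C d → InH C d
InD⇒InH {l} C euler d d∈D@(w , d≗w) = (a , (λ i → d i , moves i) , moves) , d∈D
  where
  index : Fin l → Fin (len C)
  index e = proj₁ (euler e)

  index-edge : ∀ i → index (edge C i) ≡ i
  index-edge i = distinct C _ _ (proj₂ (euler (edge C i)))

  d-injective : Injective _≡_ _≡_ d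
  d-injective {i} {j} eq = evalWord-injective w (trans (sym (d≗w i)) (trans eq (d≗w j)))

  relabel : Fin l → Fin l
  relabel e = edge C (d (index e))

  relabel-injective : Injective _≡_ _≡_ relabel
  relabel-injective {e} {e′} eq =
    trans (sym (proj₂ (euler e))) (trans (cong (edge C) (d-injective (distinct C _ _ eq)))
                                         (proj₂ (euler e′)))

  a : Aut l
  a = aut (injection⇒permutation relabel relabel-injective) idₚ

  moves : ∀ i → onE a ⟨$⟩ʳ edge C i ≡ edge C (d i)
  moves i = cong (edge C ∘ d) (index-edge i)

proposition2p2 :
    (l : ℕ) → 1 ≤ l →
    ((g : Aut l) → RegularE g ⊎ BiRegularE g →
      ∃ λ x →
        onV x ≈P onV (idA {l}) × IsLCycle (onE x) ×
        SubOf ⟨ g ⟩ ⟨ x ⟩×⟨ yA ⟩ ×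
        ( (SameSub ⟨ g ⟩ ⟨ x ⟩×⟨ yA ⟩ × OrderIs g (2 * l) × TransitiveV g × RegularE g
             × ¬ (2 ∣ l) × KernelENontrivial g)
        ⊎ (SameSub ⟨ g ⟩ ⟨ x · yA ⟩ × OrderIs g l × TransitiveV g × RegularE g × 2 ∣ l)
        ⊎ (SameSub ⟨ g ⟩ ⟨ x ⟩ × OrderIs g l × TrivialV g × RegularE g)
        ⊎ (∃ λ l₀ → l ≡ 2 * l₀ × ¬ (2 ∣ l₀) ×
             SameSub ⟨ g ⟩ ⟨ x · x ⟩×⟨ yA ⟩ × OrderIs g l × TransitiveV g × BiRegularE g
             × KernelENontrivial g)
        ⊎ (∃ λ l₀ → l ≡ 2 * l₀ × 2 ∣ l₀ ×
             SameSub ⟨ g ⟩ ⟨ (x · x) · yA ⟩ × OrderIs g l₀ × TransitiveV g × BiRegularE g)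
        ⊎ (∃ λ l₀ → l ≡ 2 * l₀ ×
             SameSub ⟨ g ⟩ ⟨ x · x ⟩ × OrderIs g l₀ × TrivialV g × BiRegularE g)))
    ×
    (((∃ λ (C : Cycle l) → EulerCycle C × Symmetrical C) ⇔ (2 ∣ l))
     × ((C : Cycle l) → EulerCycle C → Symmetrical C →
          (d : Fin (len C) → Fin (len C)) → InH C d ⇔ InD C d))
proposition2p2 l 1≤l =
  classified l 1≤l ,
  symmetricalEulerCycle⇔2∣ l ,
  λ C euler _ d → proj₂ , InD⇒InH C euler d
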